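{- Let $N_0(x)=1$, $N_{n+1}(x)=(2n+1)xN_n(x)+2x(1-x)N_n'(x)$, and write $N_n(x)=\sum_{k=1}^nN(n,k)x^k$ for $n\ge1$. Let $i=\lfloor (2n+1)/4\rfloor$ or $i=\lceil (2n+1)/4\rceil$. Then $N(n,i)=\max_{1\le k\le n}N(n,k)$. -}

module Defs where

open import Data.Nat using (ℕ; zero; suc; _/_) renaming (_+_ to _+ℕ_; _*_ to _*ℕ_)
open import Data.Integer using (ℤ; +_; _+_; _*_; -_)

-- A polynomial with integer coefficients, represented by its coefficient
-- function: p k is the coefficient of x^k (finitely supported in all uses).
Poly : Set
Poly = ℕ → ℤ

const : ℤ → Poly
const c zero    = c
const c (suc k) = + 0

mulX : Poly → Poly
mulX p zero    = + 0
mulX p (suc k) = p k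

scale : ℤ → Poly → Poly
scale c p k = c * p k

_⊕_ : Poly → Poly → Poly
(p ⊕ q) k = p k + q k

deriv : Poly → Poly
deriv p k = + (suc k) * p (suc k)

-- N_0 = 1,  N_{n+1} = (2n+1) x N_n + 2 x (1 - x) N_n'
--                    = (2n+1) x N_n + 2 x N_n' - 2 x^2 N_n'
NPoly : ℕ → Poly
NPoly zero    = const (+ 1)
NPoly (suc n) =
  scale (+ (2 *ℕ n +ℕ 1)) (mulX (NPoly n))
  ⊕ (scale (+ 2) (mulX (deriv (NPoly n)))
  ⊕ scale (- (+ 2)) (mulX (mulX (deriv (NPoly n)))))

N : ℕ → ℕ → ℤ
N n k = NPoly n k

-- ⌊(2n+1)/4⌋ and ⌈(2n+1)/4⌉ = ⌊(2n+1+3)/4⌋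
floorIdx : ℕ → ℕ
floorIdx n = (2 *ℕ n +ℕ 1) / 4

ceilIdx : ℕ → ℕ
ceilIdx n = (2 *ℕ n +ℕ 1 +ℕ 3) / 4

module Submission where

-- The coefficients of N_n rise towards the index n/2 and fall after it.
--
-- Comparing the coefficient of x^(k+1) on both sides of the defining
-- recurrence gives
--     N(n+1,k+1) = α(n,k) N(n,k) + β(k) N(n,k+1),
--     α(n,k) = 2n+1-2k,  β(k) = 2(k+1),  N(n+1,0) = 0,
-- and α(n,k) + β(k) = 2n+3 does not depend on k.  We prove by induction on n
-- that the coefficient row of N_n is nonnegative, vanishes beyond n, and is
-- balanced around n/2: for x ≤ y,
--     x + y ≤ n  ⇒  N(n,x) ≤ N(n,y)        (rising)
--     n < x + y  ⇒  N(n,y) ≤ N(n,x)        (falling).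
-- In the inductive step, N(n+1,q+1) - N(n+1,p+1) is rewritten (four cases,
-- according to the position of p + q relative to n) as a combination of
-- coefficient differences of row n with nonnegative weights, each of which is
-- nonnegative by the balance of row n.  Balance of row n gives the maximum at
-- any M with n ≤ 2M ≤ n+1; for n = 2t this is ⌊(2n+1)/4⌋ = t and for
-- n = 2t+1 it is ⌈(2n+1)/4⌉ = t+1.

open import Defs
open import Data.Nat using (ℕ) renaming (_≤_ to _≤ℕ_)
open import Data.Integer using (_≤_)
open import Data.Sum using (_⊎_)

open import Data.Nat using (zero; suc; _<_; z≤n; s≤s; s≤s⁻¹; _/_)
  renaming (_+_ to _+ℕ_; _*_ to _*ℕ_)
import Data.Nat.Properties as ℕP
open import Data.Nat.DivMod using (m*n/n≡m; m<n⇒m/n≡0; +-distrib-/-∣ˡ)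
open import Data.Nat.Divisibility using (n∣m*n)
import Data.Nat.Tactic.RingSolver as ℕSolver
open import Data.Integer using (ℤ; +_; -_; _+_; _*_; _-_; +≤+; 0ℤ)
import Data.Integer.Properties as ℤP
open import Data.Integer.Tactic.RingSolver using (solve-∀)
open import Data.Product using (∃; _,_)
open import Data.Sum using (inj₁; inj₂)
open import Relation.Binary.Definitions using (tri<; tri≈; tri>)
open import Relation.Binary.PropositionalEquality
  using (_≡_; refl; sym; trans; cong; cong₂; subst; module ≡-Reasoning)
open import Relation.Nullary using (yes; no)

α : ℕ → ℕ → ℤ
α n k = + (2 *ℕ n +ℕ 1) - + 2 * + k

β : ℕ → ℤ
β k = + 2 * (+ 1 + + k)

N-at-zero : ∀ n → N (suc n) 0 ≡ 0ℤ
N-at-zero n = trans (ℤP.+-identityʳ _) (ℤP.*-zeroʳ (+ (2 *ℕ n +ℕ 1)))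

-- The coefficient recurrence; the term -2x²N' contributes -2k N(n,k), which
-- is absent for k = 0.
N-step : ∀ n k → N (suc n) (suc k) ≡ α n k * N n k + β k * N n (suc k)
N-step n zero    = at-zero (+ (2 *ℕ n +ℕ 1)) (N n 0) (N n 1)
  where
  at-zero : ∀ A X Y →
    A * X + (+ 2 * (+ 1 * Y) + - (+ 2) * + 0) ≡ (A - + 2 * + 0) * X + + 2 * (+ 1 + + 0) * Y
  at-zero = solve-∀
N-step n (suc k) = at-suc (+ (2 *ℕ n +ℕ 1)) (+ suc k) (N n (suc k)) (N n (suc (suc k)))
  where
  at-suc : ∀ A K X Y →
    A * X + (+ 2 * ((+ 1 + K) * Y) + - (+ 2) * (K * X)) ≡ (A - + 2 * K) * X + + 2 * (+ 1 + K) * Y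
  at-suc = solve-∀

step-difference : ∀ n p q →
  N (suc n) (suc q) - N (suc n) (suc p)
    ≡ (α n q * N n q + β q * N n (suc q)) - (α n p * N n p + β p * N n (suc p))
step-difference n p q = cong₂ _-_ (N-step n q) (N-step n p)

-- The constant 2n+1 as an integer expression in n; at the centre n is a
-- function of p and q, and this exposes it to the ring solver.
odd-weight : ∀ m → + (2 *ℕ m +ℕ 1) ≡ + 2 * + m + + 1
odd-weight m = cong (_+ + 1) (ℤP.pos-* 2 m)

α-nonneg : ∀ {n k} → k ≤ℕ n → 0ℤ ≤ α n k
α-nonneg {n} {k} k≤n = ℤP.i≤j⇒0≤j-i (subst (_≤ + (2 *ℕ n +ℕ 1)) (ℤP.pos-* 2 k)
  (+≤+ (ℕP.≤-trans (ℕP.*-monoʳ-≤ 2 k≤n) (ℕP.m≤m+n (2 *ℕ n) 1))))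

β-nonneg : ∀ k → 0ℤ ≤ β k
β-nonneg k = +≤+ z≤n

nonneg-* : ∀ {i j : ℤ} → 0ℤ ≤ i → 0ℤ ≤ j → 0ℤ ≤ i * j
nonneg-* {+ a} {+ b} _ _ = subst (0ℤ ≤_) (ℤP.pos-* a b) (+≤+ z≤n)

-- a ≤ b as soon as b - a is a combination, with nonnegative weights, of
-- nonnegative differences.  Every comparison in the inductive step has this shape.
≤-byCombination : ∀ {a b u v w x x′ y y′ z z′ : ℤ} →
  b - a ≡ u * (x′ - x) + v * (y′ - y) + w * (z′ - z) →
  0ℤ ≤ u → 0ℤ ≤ v → 0ℤ ≤ w → x ≤ x′ → y ≤ y′ → z ≤ z′ → a ≤ b
≤-byCombination eq u≥0 v≥0 w≥0 x≤x′ y≤y′ z≤z′ =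
  ℤP.0≤i-j⇒j≤i (subst (0ℤ ≤_) (sym eq)
    (ℤP.+-mono-≤ (ℤP.+-mono-≤ (weighted u≥0 x≤x′) (weighted v≥0 y≤y′)) (weighted w≥0 z≤z′)))
  where
  weighted : ∀ {c s t} → 0ℤ ≤ c → s ≤ t → 0ℤ ≤ c * (t - s)
  weighted c≥0 s≤t = nonneg-* c≥0 (ℤP.i≤j⇒0≤j-i s≤t)

one-nonneg : 0ℤ ≤ + 1
one-nonneg = +≤+ z≤n

Nonneg : ℕ → Set
Nonneg n = ∀ k → 0ℤ ≤ N n k

Vanishes : ℕ → Set
Vanishes n = ∀ k → n < k → N n k ≡ 0ℤ

Rising : ℕ → Set
Rising n = ∀ {x y} → x ≤ℕ y → x +ℕ y ≤ℕ n → N n x ≤ N n y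

Falling : ℕ → Set
Falling n = ∀ {x y} → x ≤ℕ y → n < x +ℕ y → N n y ≤ N n x

-- Rising, strictly left of the centre (p + q + 2 ≤ n): using α(n,p) + β(p) = α(n,q) + β(q),
--   N(n+1,q+1) - N(n+1,p+1) = α(n,q)(N(n,q) - N(n,p+1)) + β(q)(N(n,q+1) - N(n,p+1))
--                             + α(n,p)(N(n,p+1) - N(n,p)).
rise-inner : ∀ {n p q} → Rising n → p < q → suc (suc (p +ℕ q)) ≤ℕ n →
  N (suc n) (suc p) ≤ N (suc n) (suc q)
rise-inner {n} {p} {q} rising p<q p+q+2≤n =
  ≤-byCombination
    (trans (step-difference n p q)
      (identity (+ (2 *ℕ n +ℕ 1)) (+ p) (+ q) (N n p) (N n (suc p)) (N n q) (N n (suc q))))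
    (α-nonneg (ℕP.m+n≤o⇒n≤o p p+q≤n)) (β-nonneg q) (α-nonneg (ℕP.m+n≤o⇒m≤o p p+q≤n))
    (rising p<q (ℕP.<⇒≤ p+q+2≤n))
    (rising (s≤s (ℕP.<⇒≤ p<q)) (subst (_≤ℕ n) (cong suc (sym (ℕP.+-suc p q))) p+q+2≤n))
    (rising (ℕP.n≤1+n p) (ℕP.≤-trans (ℕP.+-monoʳ-≤ p p<q) p+q≤n))
  where
  p+q≤n : p +ℕ q ≤ℕ n
  p+q≤n = ℕP.≤-trans (ℕP.n≤1+n _) (ℕP.<⇒≤ p+q+2≤n)
  identity : ∀ A P Q X Y Z W →
    ((A - + 2 * Q) * Z + + 2 * (+ 1 + Q) * W) - ((A - + 2 * P) * X + + 2 * (+ 1 + P) * Y)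
      ≡ (A - + 2 * Q) * (Z - Y) + + 2 * (+ 1 + Q) * (W - Y) + (A - + 2 * P) * (Y - X)
  identity = solve-∀

-- Rising at the centre (p + q + 1 = n), where α(n,p) = β(q) + 1 and α(n,q) = β(p) + 1:
--   N(n+1,q+1) - N(n+1,p+1) = β(p)(N(n,q) - N(n,p+1)) + β(q)(N(n,q+1) - N(n,p))
--                             + (N(n,q) - N(n,p)).
rise-centre : ∀ {n p q} → Rising n → p < q → suc (p +ℕ q) ≡ n →
  N (suc n) (suc p) ≤ N (suc n) (suc q)
rise-centre {p = p} {q} rising p<q refl =
  ≤-byCombination
    (trans (step-difference (suc (p +ℕ q)) p q)
      (identity (+ p) (+ q) (N n p) (N n (suc p)) (N n q) (N n (suc q))
        (odd-weight (suc (p +ℕ q)))))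
    (β-nonneg p) (β-nonneg q) one-nonneg
    (rising p<q ℕP.≤-refl)
    (rising (ℕP.m≤n⇒m≤1+n (ℕP.<⇒≤ p<q)) (ℕP.≤-reflexive (ℕP.+-suc p q)))
    (rising (ℕP.<⇒≤ p<q) (ℕP.n≤1+n _))
  where
  n = suc (p +ℕ q)
  identity : ∀ {A} P Q X Y Z W → A ≡ + 2 * (+ 1 + P + Q) + + 1 →
    ((A - + 2 * Q) * Z + + 2 * (+ 1 + Q) * W) - ((A - + 2 * P) * X + + 2 * (+ 1 + P) * Y)
      ≡ + 2 * (+ 1 + P) * (Z - Y) + + 2 * (+ 1 + Q) * (W - X) + + 1 * (Z - X)
  identity P Q X Y Z W refl = polynomial P Q X Y Z W
    where
    polynomial : ∀ P Q X Y Z W →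
      (((+ 2 * (+ 1 + P + Q) + + 1) - + 2 * Q) * Z + + 2 * (+ 1 + Q) * W)
        - (((+ 2 * (+ 1 + P + Q) + + 1) - + 2 * P) * X + + 2 * (+ 1 + P) * Y)
      ≡ + 2 * (+ 1 + P) * (Z - Y) + + 2 * (+ 1 + Q) * (W - X) + + 1 * (Z - X)
    polynomial = solve-∀

-- Falling at the centre (p + q = n), where α(n,p) = β(q) - 1 and α(n,q) = β(p) - 1:
--   N(n+1,p+1) - N(n+1,q+1) = β(p)(N(n,p+1) - N(n,q)) + β(q)(N(n,p) - N(n,q+1))
--                             + (N(n,q) - N(n,p)).
fall-centre : ∀ {n p q} → Rising n → Falling n → p < q → p +ℕ q ≡ n →
  N (suc n) (suc q) ≤ N (suc n) (suc p)
fall-centre {p = p} {q} rising falling p<q refl =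
  ≤-byCombination
    (trans (step-difference (p +ℕ q) q p)
      (identity (+ p) (+ q) (N n p) (N n (suc p)) (N n q) (N n (suc q))
        (odd-weight (p +ℕ q))))
    (β-nonneg p) (β-nonneg q) one-nonneg
    (falling p<q (ℕP.n<1+n _))
    (falling (ℕP.m≤n⇒m≤1+n (ℕP.<⇒≤ p<q)) (ℕP.≤-reflexive (sym (ℕP.+-suc p q))))
    (rising (ℕP.<⇒≤ p<q) ℕP.≤-refl)
  where
  n = p +ℕ q
  identity : ∀ {A} P Q X Y Z W → A ≡ + 2 * (P + Q) + + 1 →
    ((A - + 2 * P) * X + + 2 * (+ 1 + P) * Y) - ((A - + 2 * Q) * Z + + 2 * (+ 1 + Q) * W)
      ≡ + 2 * (+ 1 + P) * (Y - Z) + + 2 * (+ 1 + Q) * (X - W) + + 1 * (Z - X)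
  identity P Q X Y Z W refl = polynomial P Q X Y Z W
    where
    polynomial : ∀ P Q X Y Z W →
      (((+ 2 * (P + Q) + + 1) - + 2 * P) * X + + 2 * (+ 1 + P) * Y)
        - (((+ 2 * (P + Q) + + 1) - + 2 * Q) * Z + + 2 * (+ 1 + Q) * W)
      ≡ + 2 * (+ 1 + P) * (Y - Z) + + 2 * (+ 1 + Q) * (X - W) + + 1 * (Z - X)
    polynomial = solve-∀

fall-outer : ∀ {n p q} → Falling n → p < q → n < p +ℕ q → q ≤ℕ n →
  N (suc n) (suc q) ≤ N (suc n) (suc p)
fall-outer {n} {p} {q} falling p<q n<p+q q≤n =
  ≤-byCombination
    (trans (step-difference n q p)
      (identity (+ (2 *ℕ n +ℕ 1)) (+ p) (+ q) (N n p) (N n (suc p)) (N n q) (N n (suc q))))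
    (α-nonneg (ℕP.≤-trans (ℕP.<⇒≤ p<q) q≤n)) (β-nonneg p) (β-nonneg q)
    (falling (ℕP.<⇒≤ p<q) n<p+q)
    (falling p<q (ℕP.m<n⇒m<1+n n<p+q))
    (falling (ℕP.n≤1+n q) (ℕP.<-≤-trans n<p+q (ℕP.+-mono-≤ (ℕP.<⇒≤ p<q) (ℕP.n≤1+n q))))
  where
  identity : ∀ A P Q X Y Z W →
    ((A - + 2 * P) * X + + 2 * (+ 1 + P) * Y) - ((A - + 2 * Q) * Z + + 2 * (+ 1 + Q) * W)
      ≡ (A - + 2 * P) * (X - Z) + + 2 * (+ 1 + P) * (Y - Z) + + 2 * (+ 1 + Q) * (Z - W)
  identity = solve-∀

vanishes-step : ∀ {n} → Vanishes n → Vanishes (suc n)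
vanishes-step {n} vanishes (suc k) (s≤s n<k) = begin
  N (suc n) (suc k)                      ≡⟨ N-step n k ⟩
  α n k * N n k + β k * N n (suc k)      ≡⟨ cong₂ (λ a b → α n k * a + β k * b)
                                              (vanishes k n<k) (vanishes (suc k) (ℕP.m<n⇒m<1+n n<k)) ⟩
  α n k * 0ℤ + β k * 0ℤ                  ≡⟨ cong₂ _+_ (ℤP.*-zeroʳ (α n k)) (ℤP.*-zeroʳ (β k)) ⟩
  0ℤ                                     ∎
  where open ≡-Reasoning

nonneg-step : ∀ {n} → Nonneg n → Vanishes (suc n) → Nonneg (suc n)
nonneg-step {n} nonneg vanishes zero = ℤP.≤-reflexive (sym (N-at-zero n))
nonneg-step {n} nonneg vanishes (suc k) with k ℕP.≤? n
... | yes k≤n = subst (0ℤ ≤_) (sym (N-step n k))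
                  (ℤP.+-mono-≤ (nonneg-* (α-nonneg k≤n) (nonneg k)) (nonneg-* (β-nonneg k) (nonneg (suc k))))
... | no k≰n  = ℤP.≤-reflexive (sym (vanishes (suc k) (s≤s (ℕP.≰⇒> k≰n))))

rising-step : ∀ {n} → Rising n → Nonneg (suc n) → Rising (suc n)
rising-step {n} rising nonneg {zero} {y} _ _ = subst (_≤ N (suc n) y) (sym (N-at-zero n)) (nonneg y)
rising-step {n} rising nonneg {suc p} {suc q} (s≤s p≤q) p+q+2≤n+1 with ℕP.m≤n⇒m<n∨m≡n p≤q
... | inj₂ refl = ℤP.≤-refl
... | inj₁ p<q with ℕP.m≤n⇒m<n∨m≡n (subst (_≤ℕ n) (ℕP.+-suc p q) (s≤s⁻¹ p+q+2≤n+1))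
...   | inj₁ inner  = rise-inner rising p<q inner
...   | inj₂ centre = rise-centre rising p<q centre

falling-step : ∀ {n} → Rising n → Falling n → Nonneg (suc n) → Vanishes (suc n) → Falling (suc n)
falling-step {n} rising falling nonneg vanishes {zero} {suc q} _ n+1<q+1 =
  ℤP.≤-reflexive (trans (vanishes (suc q) n+1<q+1) (sym (N-at-zero n)))
falling-step {n} rising falling nonneg vanishes {suc p} {suc q} (s≤s p≤q) n+1<p+q+2
  with ℕP.m≤n⇒m<n∨m≡n p≤q
... | inj₂ refl = ℤP.≤-refl
... | inj₁ p<q with ℕP.m≤n⇒m<n∨m≡n (s≤s⁻¹ (subst (n <_) (ℕP.+-suc p q) (s≤s⁻¹ n+1<p+q+2)))
...   | inj₂ centre = fall-centre rising falling p<q (sym centre)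
...   | inj₁ outer with q ℕP.≤? n
...     | yes q≤n = fall-outer falling p<q outer q≤n
...     | no q≰n  = subst (_≤ N (suc n) (suc p)) (sym (vanishes (suc q) (s≤s (ℕP.≰⇒> q≰n))))
                      (nonneg (suc p))

record Shape (n : ℕ) : Set where
  field
    nonneg   : Nonneg n
    vanishes : Vanishes n
    rising   : Rising n
    falling  : Falling n

shape-zero : Shape 0
shape-zero = record { nonneg = nonneg ; vanishes = vanishes ; rising = rising ; falling = falling }
  where
  nonneg : Nonneg 0
  nonneg zero    = +≤+ z≤n
  nonneg (suc k) = +≤+ z≤n
  vanishes : Vanishes 0
  vanishes (suc k) _ = refl
  rising : Rising 0
  rising {zero} {zero} _ _ = ℤP.≤-refl
  falling : Falling 0
  falling {zero} {zero} _ ()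
  falling {x} {suc y} _ _ = nonneg x

shape : ∀ n → Shape n
shape zero    = shape-zero
shape (suc n) = record
  { nonneg   = nonneg′
  ; vanishes = vanishes′
  ; rising   = rising-step rising nonneg′
  ; falling  = falling-step rising falling nonneg′ vanishes′
  }
  where
  open Shape (shape n)
  vanishes′ : Vanishes (suc n)
  vanishes′ = vanishes-step vanishes
  nonneg′ : Nonneg (suc n)
  nonneg′ = nonneg-step nonneg vanishes′

-- A balanced row attains its maximum at any M with n ≤ 2M ≤ n+1: indices
-- k < M satisfy k + M ≤ n, indices k > M satisfy n < M + k.
maximum-at-centre : ∀ {n M} → Rising n → Falling n → n ≤ℕ M +ℕ M → M +ℕ M ≤ℕ suc n →
  ∀ k → N n k ≤ N n M
maximum-at-centre {n} {M} rising falling n≤2M 2M≤n+1 k with ℕP.<-cmp k M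
... | tri< k<M _ _ = rising (ℕP.<⇒≤ k<M) (s≤s⁻¹ (ℕP.<-≤-trans (ℕP.+-monoˡ-< M k<M) 2M≤n+1))
... | tri≈ _ refl _ = ℤP.≤-refl
... | tri> _ _ M<k = falling (ℕP.<⇒≤ M<k) (ℕP.≤-<-trans n≤2M (ℕP.+-monoʳ-< M M<k))

even-or-odd : ∀ n → ∃ (λ t → n ≡ t +ℕ t) ⊎ ∃ (λ t → n ≡ suc (t +ℕ t))
even-or-odd zero = inj₁ (0 , refl)
even-or-odd (suc n) with even-or-odd n
... | inj₁ (t , n≡2t)   = inj₂ (t , cong suc n≡2t)
... | inj₂ (t , n≡2t+1) = inj₁ (suc t , trans (cong suc n≡2t+1) (cong suc (sym (ℕP.+-suc t t))))

quotient-by-4 : ∀ t r → r < 4 → (t *ℕ 4 +ℕ r) / 4 ≡ t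
quotient-by-4 t r r<4 = begin
  (t *ℕ 4 +ℕ r) / 4       ≡⟨ +-distrib-/-∣ˡ r (n∣m*n t) ⟩
  t *ℕ 4 / 4 +ℕ r / 4     ≡⟨ cong₂ _+ℕ_ (m*n/n≡m t 4) (m<n⇒m/n≡0 r<4) ⟩
  t +ℕ 0                  ≡⟨ ℕP.+-identityʳ t ⟩
  t                       ∎
  where open ≡-Reasoning

floorIdx-even : ∀ t → floorIdx (t +ℕ t) ≡ t
floorIdx-even t = trans (cong (_/ 4) (base-4 t)) (quotient-by-4 t 1 (ℕP.m≤m+n 2 2))
  where
  base-4 : ∀ t → 2 *ℕ (t +ℕ t) +ℕ 1 ≡ t *ℕ 4 +ℕ 1
  base-4 = ℕSolver.solve-∀

ceilIdx-odd : ∀ t → ceilIdx (suc (t +ℕ t)) ≡ suc t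
ceilIdx-odd t = trans (cong (_/ 4) (base-4 t)) (quotient-by-4 (suc t) 2 (ℕP.m≤m+n 3 1))
  where
  base-4 : ∀ t → 2 *ℕ suc (t +ℕ t) +ℕ 1 +ℕ 3 ≡ suc t *ℕ 4 +ℕ 2
  base-4 = ℕSolver.solve-∀

mainTheorem12 : (n : ℕ) → 1 ≤ℕ n →
    ((k : ℕ) → 1 ≤ℕ k → k ≤ℕ n → N n k ≤ N n (floorIdx n))
    ⊎ ((k : ℕ) → 1 ≤ℕ k → k ≤ℕ n → N n k ≤ N n (ceilIdx n))
mainTheorem12 n _ with even-or-odd n
... | inj₁ (t , refl) = inj₁ λ k _ _ → subst (λ M → N n k ≤ N n M) (sym (floorIdx-even t))
        (maximum-at-centre rising falling ℕP.≤-refl (ℕP.n≤1+n n) k)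
  where open Shape (shape n)
... | inj₂ (t , refl) = inj₂ λ k _ _ → subst (λ M → N n k ≤ N n M) (sym (ceilIdx-odd t))
        (maximum-at-centre rising falling (ℕP.≤-trans (ℕP.n≤1+n n) (ℕP.≤-reflexive (sym 2M≡n+1)))
          (ℕP.≤-reflexive 2M≡n+1) k)
  where
  open Shape (shape n)
  2M≡n+1 : suc t +ℕ suc t ≡ suc n
  2M≡n+1 = cong suc (ℕP.+-suc t t)
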